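{- Let $K$ be a set, and let $A=(X,S)$ and $B=(Y,T)$ be syntactic propositions over $K$ (as defined in the context). Let $R\subseteq X\times Y$ be a binary relation respecting labels (i.e. $xRy$ only if $x$ and $y$ carry the same label). Then the following are equivalent: (i) ($R$ satisfies the resolution condition) for every $t\in T$, the inverse image $R^{ -1}(t)=\{x\in X:\exists y\in t,\ xRy\}$ belongs to $S$, and for every $\alpha\in S^{\perp}$, the direct image $R(\alpha)=\{y\in Y:\exists x\in\alpha,\ xRy\}$ belongs to $T^{\perp}$; (ii) for every $t\in T$ and every $\alpha\in S^{\perp}$ there is exactly one pair $(x,y)$ with $x\in\alpha$, $y\in t$ and $xRy$.
   Context: For a set $X$ and subsets $s,t\subseteq X$, write $s\perp t$ if $s\cap t$ has exactly one element. For a set $S$ of subsets of $X$, $S^{\perp}=\{t\subseteq X: t\perp s\text{ for all }s\in S\}$. An abstract proposition (with labels in a set $K$) is a pair $(X,S)$ where $X$ is a set of leaves, each labelled by an element of $K$, and $S$ is a set of subsets of $X$ (the resolutions) with $S^{\perp\perp}=S$; elements of $S^{\perp}$ are called coresolutions. A syntactic proposition is one arising from a formula $\phi$ built from elements of $K$ by the binary connectives $\wedge$ and $\vee$: $X$ is the set of leaf occurrences of $\phi$ (labelled by their elements of $K$), and $S$ is the set of maximal sets of leaves no two of which meet at a $\wedge$-node in the parse tree of $\phi$ (equivalently, the maximal independent sets of the graph on $X$ with an edge $xy$ iff $x$ and $y$ meet at a $\wedge$ in the parse tree). -}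

module Defs where

open import Data.Bool using (Bool; true; false; _∧_; _∨_)
open import Data.Unit using (⊤; tt)
open import Data.Empty using (⊥)
open import Data.Sum using (_⊎_; inj₁; inj₂)
open import Data.Product using (Σ; ∃; _×_; _,_)
open import Relation.Nullary using (¬_)
open import Relation.Binary.PropositionalEquality using (_≡_)

data Formula (K : Set) : Set where
  atom : K → Formula K
  _and_ : Formula K → Formula K → Formula K
  _or_  : Formula K → Formula K → Formula K

Leaf : {K : Set} → Formula K → Set
Leaf (atom _)  = ⊤
Leaf (φ and ψ) = Leaf φ ⊎ Leaf ψ
Leaf (φ or ψ)  = Leaf φ ⊎ Leaf ψ

label : {K : Set} (φ : Formula K) → Leaf φ → K
label (atom k)  _        = k
label (φ and ψ) (inj₁ x) = label φ x
label (φ and ψ) (inj₂ y) = label ψ y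
label (φ or ψ)  (inj₁ x) = label φ x
label (φ or ψ)  (inj₂ y) = label ψ y

-- x and y meet at a ∧-node of the parse tree (their lowest common
-- ancestor is a ∧-node).
MeetAnd : {K : Set} (φ : Formula K) → Leaf φ → Leaf φ → Set
MeetAnd (atom _)  _        _        = ⊥
MeetAnd (φ and ψ) (inj₁ x) (inj₁ y) = MeetAnd φ x y
MeetAnd (φ and ψ) (inj₁ _) (inj₂ _) = ⊤
MeetAnd (φ and ψ) (inj₂ _) (inj₁ _) = ⊤
MeetAnd (φ and ψ) (inj₂ x) (inj₂ y) = MeetAnd ψ x y
MeetAnd (φ or ψ)  (inj₁ x) (inj₁ y) = MeetAnd φ x y
MeetAnd (φ or ψ)  (inj₁ _) (inj₂ _) = ⊥
MeetAnd (φ or ψ)  (inj₂ _) (inj₁ _) = ⊥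
MeetAnd (φ or ψ)  (inj₂ x) (inj₂ y) = MeetAnd ψ x y

Subset : {K : Set} → Formula K → Set
Subset φ = Leaf φ → Bool

_∈_ : {K : Set} {φ : Formula K} → Leaf φ → Subset φ → Set
x ∈ s = s x ≡ true

_⊆_ : {K : Set} {φ : Formula K} → Subset φ → Subset φ → Set
s ⊆ t = ∀ x → x ∈ s → x ∈ t

Independent : {K : Set} (φ : Formula K) → Subset φ → Set
Independent φ s = ∀ x y → x ∈ s → y ∈ s → ¬ MeetAnd φ x y

IsResolution : {K : Set} (φ : Formula K) → Subset φ → Set
IsResolution φ s =
  Independent φ s × (∀ s′ → Independent φ s′ → s ⊆ s′ → s′ ⊆ s)

_⊥ₛ_ : {K : Set} {φ : Formula K} → Subset φ → Subset φ → Set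
_⊥ₛ_ {φ = φ} s t =
  Σ (Leaf φ) λ x → x ∈ s × x ∈ t × (∀ y → y ∈ s → y ∈ t → y ≡ x)

IsCoresolution : {K : Set} (φ : Formula K) → Subset φ → Set
IsCoresolution φ α = ∀ s → IsResolution φ s → α ⊥ₛ s

anyLeaf : {K : Set} (φ : Formula K) → (Leaf φ → Bool) → Bool
anyLeaf (atom _)  p = p tt
anyLeaf (φ and ψ) p = anyLeaf φ (λ x → p (inj₁ x)) ∨ anyLeaf ψ (λ y → p (inj₂ y))
anyLeaf (φ or ψ)  p = anyLeaf φ (λ x → p (inj₁ x)) ∨ anyLeaf ψ (λ y → p (inj₂ y))

-- a relation R ⊆ X × Y (decidable, X and Y being finite)
Rel : {K : Set} → Formula K → Formula K → Set
Rel φ ψ = Leaf φ → Leaf ψ → Bool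

RespectsLabels : {K : Set} (φ ψ : Formula K) → Rel φ ψ → Set
RespectsLabels φ ψ R = ∀ x y → R x y ≡ true → label φ x ≡ label ψ y

preimage : {K : Set} (φ ψ : Formula K) → Rel φ ψ → Subset ψ → Subset φ
preimage φ ψ R t x = anyLeaf ψ (λ y → t y ∧ R x y)

image : {K : Set} (φ ψ : Formula K) → Rel φ ψ → Subset φ → Subset ψ
image φ ψ R α y = anyLeaf φ (λ x → α x ∧ R x y)

ResolutionCondition : {K : Set} (φ ψ : Formula K) → Rel φ ψ → Set
ResolutionCondition φ ψ R =
  (∀ t → IsResolution ψ t → IsResolution φ (preimage φ ψ R t))
  × (∀ α → IsCoresolution φ α → IsCoresolution ψ (image φ ψ R α))

UniquePair : {K : Set} (φ ψ : Formula K) → Rel φ ψ → Set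
UniquePair φ ψ R =
  ∀ t → IsResolution ψ t → ∀ α → IsCoresolution φ α →
  Σ (Leaf φ × Leaf ψ) λ { (x , y) →
    x ∈ α × y ∈ t × R x y ≡ true ×
    (∀ x′ y′ → x′ ∈ α → y′ ∈ t → R x′ y′ ≡ true → (x′ , y′) ≡ (x , y)) }

{-# OPTIONS --safe #-}
-- Condition (ii) for a pair (t, α) says exactly that α ⟂ R⁻¹(t) and R(α) ⟂ t.
-- Hence (i) ⇒ (ii) is immediate, and (ii) ⇒ (i) reduces to S^⊥⊥ ⊆ S for the
-- syntactic proposition of φ.
--
-- The ∧-meeting graph of φ ∧ ψ is the join, and that of φ ∨ ψ the disjoint
-- union, of the graphs of φ and ψ. So a resolution of φ ∧ ψ is a resolution of
-- one side and empty on the other, and a resolution of φ ∨ ψ is a union of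
-- resolutions of both sides. Orthogonality swaps these two constructions: the
-- orthogonal of a one-side family is the both-sides family of the orthogonals,
-- and conversely when the families cover their nonempty leaf sets. By induction
-- on φ, S^⊥ is described by the same recursion with ∧ and ∨ exchanged, and S is
-- in turn the orthogonal of S^⊥.
module Submission where

open import Data.Bool using (Bool; true; false; _∧_; _∨_)
open import Data.Bool.Properties using (_≟_)
open import Data.Empty using (⊥; ⊥-elim)
open import Data.Product using (Σ; ∃; _×_; _,_; proj₁; proj₂; map; map₂)
open import Data.Product.Function.NonDependent.Propositional using (_×-⇔_)
open import Data.Sum using (_⊎_; inj₁; inj₂; [_,_])
open import Data.Sum.Function.Propositional using (_⊎-⇔_)
open import Data.Sum.Properties using (inj₁-injective; inj₂-injective)
open import Data.Unit using (tt)
open import Function using (_∘_; _on_; const; id)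
open import Function.Bundles using (_⇔_; mk⇔; Equivalence)
open import Function.Construct.Composition using (_⇔-∘_)
open import Function.Construct.Identity using (⇔-id)
open import Function.Construct.Symmetry using (⇔-sym)
open import Relation.Nullary using (¬_; Dec; yes; no)
open import Relation.Nullary.Decidable using (map′)
open import Relation.Binary.PropositionalEquality using (_≡_; refl; sym; trans; cong; cong₂; subst)

open import Defs hiding (_∈_; _⊆_)

open Equivalence using (to; from)

∧≡true : ∀ {a b} → a ∧ b ≡ true ⇔ (a ≡ true × b ≡ true)
∧≡true {true}  = mk⇔ (refl ,_) proj₂
∧≡true {false} = mk⇔ (λ ()) proj₁

∨≡true-⊎ : {A B : Set} {p : A ⊎ B → Bool} {a b : Bool} →
           a ≡ true ⇔ (∃ λ x → p (inj₁ x) ≡ true) → b ≡ true ⇔ (∃ λ y → p (inj₂ y) ≡ true) →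
           a ∨ b ≡ true ⇔ (∃ λ z → p z ≡ true)
∨≡true-⊎ {a = true}  a⇔ _  = mk⇔ (λ _ → map inj₁ id (to a⇔ refl)) (λ _ → refl)
∨≡true-⊎ {p = p} {false} {b} a⇔ b⇔ = mk⇔ (map inj₂ id ∘ to b⇔) witness⇒b
  where
  witness⇒b : (∃ λ z → p z ≡ true) → b ≡ true
  witness⇒b (inj₁ x , px) with () ← from a⇔ (x , px)
  witness⇒b (inj₂ y , py) = from b⇔ (y , py)

-- Membership and inclusion of Defs, for subsets of an arbitrary type; on leaves
-- they agree definitionally with the hidden originals.
module _ {L : Set} where

  infix 4 _∈_ _⊆_ _⟂_

  _∈_ : L → (L → Bool) → Set
  x ∈ s = s x ≡ true

  _⊆_ : (L → Bool) → (L → Bool) → Set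
  s ⊆ t = ∀ x → x ∈ s → x ∈ t

  Empty : (L → Bool) → Set
  Empty s = ∀ x → ¬ x ∈ s

  Nonempty : (L → Bool) → Set
  Nonempty s = ∃ λ x → x ∈ s

  _⟂_ : (L → Bool) → (L → Bool) → Set
  s ⟂ t = Σ L λ x → x ∈ s × x ∈ t × (∀ y → y ∈ s → y ∈ t → y ≡ x)

  ⟂-sym : {s t : L → Bool} → s ⟂ t → t ⟂ s
  ⟂-sym (x , x∈s , x∈t , unique) = x , x∈t , x∈s , λ y y∈t y∈s → unique y y∈s y∈t

  ⟂-unique : {s t : L → Bool} {x y : L} → s ⟂ t → x ∈ s → x ∈ t → y ∈ s → y ∈ t → x ≡ y
  ⟂-unique (_ , _ , _ , unique) x∈s x∈t y∈s y∈t = trans (unique _ x∈s x∈t) (sym (unique _ y∈s y∈t))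

  Orth : ((L → Bool) → Set) → (L → Bool) → Set
  Orth 𝒫 u = ∀ α → 𝒫 α → u ⟂ α

  Covers : ((L → Bool) → Set) → Set
  Covers 𝒫 = ∀ x → ∃ λ α → 𝒫 α × x ∈ α

module _ {A B : Set} where

  ⊆-⊎ : {s t : A ⊎ B → Bool} → (s ∘ inj₁) ⊆ (t ∘ inj₁) → (s ∘ inj₂) ⊆ (t ∘ inj₂) → s ⊆ t
  ⊆-⊎ sub₁ sub₂ (inj₁ a) = sub₁ a
  ⊆-⊎ sub₁ sub₂ (inj₂ b) = sub₂ b

  ⟂-restrictˡ : {u v : A ⊎ B → Bool} → (∀ b → inj₂ b ∈ u → inj₂ b ∈ v → ⊥) →
                u ⟂ v ⇔ (u ∘ inj₁) ⟂ (v ∘ inj₁)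
  ⟂-restrictˡ {u} {v} disjoint = mk⇔ restrict extend
    where
    restrict : u ⟂ v → (u ∘ inj₁) ⟂ (v ∘ inj₁)
    restrict (inj₁ a , a∈u , a∈v , unique) =
      a , a∈u , a∈v , λ a′ a′∈u a′∈v → inj₁-injective (unique (inj₁ a′) a′∈u a′∈v)
    restrict (inj₂ b , b∈u , b∈v , _) = ⊥-elim (disjoint b b∈u b∈v)
    extend : (u ∘ inj₁) ⟂ (v ∘ inj₁) → u ⟂ v
    extend (a , a∈u , a∈v , unique) = inj₁ a , a∈u , a∈v , unique′
      where
      unique′ : ∀ x → x ∈ u → x ∈ v → x ≡ inj₁ a
      unique′ (inj₁ a′) a′∈u a′∈v = cong inj₁ (unique a′ a′∈u a′∈v)
      unique′ (inj₂ b) b∈u b∈v = ⊥-elim (disjoint b b∈u b∈v)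

  ⟂-restrictʳ : {u v : A ⊎ B → Bool} → (∀ a → inj₁ a ∈ u → inj₁ a ∈ v → ⊥) →
                u ⟂ v ⇔ (u ∘ inj₂) ⟂ (v ∘ inj₂)
  ⟂-restrictʳ {u} {v} disjoint = mk⇔ restrict extend
    where
    restrict : u ⟂ v → (u ∘ inj₂) ⟂ (v ∘ inj₂)
    restrict (inj₂ b , b∈u , b∈v , unique) =
      b , b∈u , b∈v , λ b′ b′∈u b′∈v → inj₂-injective (unique (inj₂ b′) b′∈u b′∈v)
    restrict (inj₁ a , a∈u , a∈v , _) = ⊥-elim (disjoint a a∈u a∈v)
    extend : (u ∘ inj₂) ⟂ (v ∘ inj₂) → u ⟂ v
    extend (b , b∈u , b∈v , unique) = inj₂ b , b∈u , b∈v , unique′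
      where
      unique′ : ∀ x → x ∈ u → x ∈ v → x ≡ inj₂ b
      unique′ (inj₂ b′) b′∈u b′∈v = cong inj₂ (unique b′ b′∈u b′∈v)
      unique′ (inj₁ a) a∈u a∈v = ⊥-elim (disjoint a a∈u a∈v)

  OneSide : ((A → Bool) → Set) → ((B → Bool) → Set) → (A ⊎ B → Bool) → Set
  OneSide P Q s = (P (s ∘ inj₁) × Empty (s ∘ inj₂)) ⊎ (Empty (s ∘ inj₁) × Q (s ∘ inj₂))

  BothSides : ((A → Bool) → Set) → ((B → Bool) → Set) → (A ⊎ B → Bool) → Set
  BothSides P Q s = P (s ∘ inj₁) × Q (s ∘ inj₂)

  module _ {P P′ : (A → Bool) → Set} {Q Q′ : (B → Bool) → Set} where

    OneSide-cong : (∀ s → P s ⇔ P′ s) → (∀ s → Q s ⇔ Q′ s) →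
                   ∀ s → OneSide P Q s ⇔ OneSide P′ Q′ s
    OneSide-cong P⇔P′ Q⇔Q′ s = (P⇔P′ _ ×-⇔ ⇔-id _) ⊎-⇔ (⇔-id _ ×-⇔ Q⇔Q′ _)

    BothSides-cong : (∀ s → P s ⇔ P′ s) → (∀ s → Q s ⇔ Q′ s) →
                     ∀ s → BothSides P Q s ⇔ BothSides P′ Q′ s
    BothSides-cong P⇔P′ Q⇔Q′ s = P⇔P′ _ ×-⇔ Q⇔Q′ _

  module _ {P : (A → Bool) → Set} {Q : (B → Bool) → Set} where

    OneSide-covers : Covers P → Covers Q → Covers (OneSide P Q)
    OneSide-covers coverP coverQ (inj₁ a) =
      let (α , α∈P , a∈α) = coverP a in [ α , const false ] , inj₁ (α∈P , λ _ ()) , a∈α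
    OneSide-covers coverP coverQ (inj₂ b) =
      let (β , β∈Q , b∈β) = coverQ b in [ const false , β ] , inj₂ ((λ _ ()) , β∈Q) , b∈β

    BothSides-covers : Covers P → Covers Q → A → B → Covers (BothSides P Q)
    BothSides-covers coverP coverQ a₀ b₀ (inj₁ a) =
      let (α , α∈P , a∈α) = coverP a ; (β , β∈Q , _) = coverQ b₀
      in [ α , β ] , (α∈P , β∈Q) , a∈α
    BothSides-covers coverP coverQ a₀ b₀ (inj₂ b) =
      let (α , α∈P , _) = coverP a₀ ; (β , β∈Q , b∈β) = coverQ b
      in [ α , β ] , (α∈P , β∈Q) , b∈β

    Orth-OneSide : ∀ u → Orth (OneSide P Q) u ⇔ BothSides (Orth P) (Orth Q) u
    Orth-OneSide u = mk⇔ split merge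
      where
      split : Orth (OneSide P Q) u → BothSides (Orth P) (Orth Q) u
      split u⟂ =
        (λ α α∈P → to (⟂-restrictˡ λ _ _ ()) (u⟂ [ α , const false ] (inj₁ (α∈P , λ _ ())))) ,
        (λ β β∈Q → to (⟂-restrictʳ λ _ _ ()) (u⟂ [ const false , β ] (inj₂ ((λ _ ()) , β∈Q))))
      merge : BothSides (Orth P) (Orth Q) u → Orth (OneSide P Q) u
      merge (u₁⟂ , _) v (inj₁ (v₁∈P , v₂-empty)) =
        from (⟂-restrictˡ λ b _ b∈v → v₂-empty b b∈v) (u₁⟂ _ v₁∈P)
      merge (_ , u₂⟂) v (inj₂ (v₁-empty , v₂∈Q)) =
        from (⟂-restrictʳ λ a _ a∈v → v₁-empty a a∈v) (u₂⟂ _ v₂∈Q)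

    -- A member of BothSides P Q containing both points would meet u twice.
    Orth-BothSides-one-sided : Covers P → Covers Q → ∀ {u a b} →
                               Orth (BothSides P Q) u → inj₁ a ∈ u → inj₂ b ∈ u → ⊥
    Orth-BothSides-one-sided coverP coverQ {a = a} {b} u⟂ a∈u b∈u with coverP a | coverQ b
    ... | α , α∈P , a∈α | β , β∈Q , b∈β
      with () ← ⟂-unique {x = inj₁ a} {inj₂ b} (u⟂ [ α , β ] (α∈P , β∈Q)) a∈u a∈α b∈u b∈β

    Orth-BothSides : Covers P → Covers Q → A → B →
                     ∀ u → Orth (BothSides P Q) u ⇔ OneSide (Orth P) (Orth Q) u
    Orth-BothSides coverP coverQ a₀ b₀ u = mk⇔ split merge
      where
      α₀ = proj₁ (coverP a₀)
      β₀ = proj₁ (coverQ b₀)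
      α₀∈P = proj₁ (proj₂ (coverP a₀))
      β₀∈Q = proj₁ (proj₂ (coverQ b₀))

      split : Orth (BothSides P Q) u → OneSide (Orth P) (Orth Q) u
      split u⟂ with u⟂ [ α₀ , β₀ ] (α₀∈P , β₀∈Q)
      ... | inj₁ a , a∈u , _ =
        let u₂-empty = λ b b∈u → Orth-BothSides-one-sided coverP coverQ u⟂ a∈u b∈u
        in inj₁ ( (λ α α∈P → to (⟂-restrictˡ λ b b∈u _ → u₂-empty b b∈u)
                                  (u⟂ [ α , β₀ ] (α∈P , β₀∈Q)))
                , u₂-empty)
      ... | inj₂ b , b∈u , _ =
        let u₁-empty = λ a a∈u → Orth-BothSides-one-sided coverP coverQ u⟂ a∈u b∈u
        in inj₂ ( u₁-empty
                , λ β β∈Q → to (⟂-restrictʳ λ a a∈u _ → u₁-empty a a∈u)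
                                 (u⟂ [ α₀ , β ] (α₀∈P , β∈Q)))

      merge : OneSide (Orth P) (Orth Q) u → Orth (BothSides P Q) u
      merge (inj₁ (u₁⟂ , u₂-empty)) v (v₁∈P , _) =
        from (⟂-restrictˡ λ b b∈u _ → u₂-empty b b∈u) (u₁⟂ _ v₁∈P)
      merge (inj₂ (u₁-empty , u₂⟂)) v (_ , v₂∈Q) =
        from (⟂-restrictʳ λ a a∈u _ → u₁-empty a a∈u) (u₂⟂ _ v₂∈Q)

module _ {L : Set} (E : L → L → Set) where

  Stable : (L → Bool) → Set
  Stable s = ∀ x y → x ∈ s → y ∈ s → ¬ E x y

  -- IsResolution φ unfolds to MaximalStable (MeetAnd φ).
  MaximalStable : (L → Bool) → Set
  MaximalStable s = Stable s × (∀ s′ → Stable s′ → s ⊆ s′ → s′ ⊆ s)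

module _ {A B : Set} (E : A ⊎ B → A ⊎ B → Set) where

  stable-⊎ : {s : A ⊎ B → Bool} →
             Stable (E on inj₁) (s ∘ inj₁) → Stable (E on inj₂) (s ∘ inj₂) →
             (∀ a b → inj₁ a ∈ s → inj₂ b ∈ s → ¬ E (inj₁ a) (inj₂ b) × ¬ E (inj₂ b) (inj₁ a)) →
             Stable E s
  stable-⊎ st₁ st₂ cross (inj₁ a) (inj₁ a′) = st₁ a a′
  stable-⊎ st₁ st₂ cross (inj₁ a) (inj₂ b) a∈s b∈s = proj₁ (cross a b a∈s b∈s)
  stable-⊎ st₁ st₂ cross (inj₂ b) (inj₁ a) b∈s a∈s = proj₂ (cross a b a∈s b∈s)
  stable-⊎ st₁ st₂ cross (inj₂ b) (inj₂ b′) = st₂ b b′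

  stable-restrictˡ : {s : A ⊎ B → Bool} → Stable E s → Stable (E on inj₁) (s ∘ inj₁)
  stable-restrictˡ st a a′ = st (inj₁ a) (inj₁ a′)

  stable-restrictʳ : {s : A ⊎ B → Bool} → Stable E s → Stable (E on inj₂) (s ∘ inj₂)
  stable-restrictʳ st b b′ = st (inj₂ b) (inj₂ b′)

  stable-emptyʳ : {s : A ⊎ B → Bool} → Stable (E on inj₁) (s ∘ inj₁) → Empty (s ∘ inj₂) → Stable E s
  stable-emptyʳ st₁ s₂-empty =
    stable-⊎ st₁ (λ b _ b∈s → ⊥-elim (s₂-empty b b∈s)) (λ _ b _ b∈s → ⊥-elim (s₂-empty b b∈s))

  stable-emptyˡ : {s : A ⊎ B → Bool} → Empty (s ∘ inj₁) → Stable (E on inj₂) (s ∘ inj₂) → Stable E s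
  stable-emptyˡ s₁-empty st₂ =
    stable-⊎ (λ a _ a∈s → ⊥-elim (s₁-empty a a∈s)) st₂ (λ a _ a∈s _ → ⊥-elim (s₁-empty a a∈s))

  maximalStable-union : (∀ a b → ¬ E (inj₁ a) (inj₂ b) × ¬ E (inj₂ b) (inj₁ a)) →
    ∀ s → MaximalStable E s ⇔ BothSides (MaximalStable (E on inj₁)) (MaximalStable (E on inj₂)) s
  maximalStable-union disconnected s = mk⇔ split merge
    where
    split : MaximalStable E s → BothSides (MaximalStable (E on inj₁)) (MaximalStable (E on inj₂)) s
    split (st , maximal) =
      ( stable-restrictˡ st
      , λ s′ st′ s₁⊆s′ a → maximal [ s′ , s ∘ inj₂ ]
          (stable-⊎ st′ (stable-restrictʳ st) λ a b _ _ → disconnected a b)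
          (⊆-⊎ s₁⊆s′ (λ _ → id)) (inj₁ a))
      , ( stable-restrictʳ st
        , λ s′ st′ s₂⊆s′ b → maximal [ s ∘ inj₁ , s′ ]
            (stable-⊎ (stable-restrictˡ st) st′ λ a b _ _ → disconnected a b)
            (⊆-⊎ (λ _ → id) s₂⊆s′) (inj₂ b))
    merge : BothSides (MaximalStable (E on inj₁)) (MaximalStable (E on inj₂)) s → MaximalStable E s
    merge ((st₁ , maximal₁) , (st₂ , maximal₂)) =
      stable-⊎ st₁ st₂ (λ a b _ _ → disconnected a b) ,
      λ s′ st′ s⊆s′ → ⊆-⊎
        (maximal₁ (s′ ∘ inj₁) (stable-restrictˡ st′) (λ a → s⊆s′ (inj₁ a)))
        (maximal₂ (s′ ∘ inj₂) (stable-restrictʳ st′) (λ b → s⊆s′ (inj₂ b)))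

  -- Constructively, telling on which side a maximal stable set lies needs nonempty?.
  module _ (complete : ∀ a b → E (inj₁ a) (inj₂ b))
           (nonempty₁ : ∀ {s} → MaximalStable (E on inj₁) s → Nonempty s)
           (nonempty₂ : ∀ {s} → MaximalStable (E on inj₂) s → Nonempty s)
           (nonempty? : ∀ (s : A → Bool) → Dec (Nonempty s)) where

    maximalStable-join :
      ∀ s → MaximalStable E s ⇔ OneSide (MaximalStable (E on inj₁)) (MaximalStable (E on inj₂)) s
    maximalStable-join s = mk⇔ split merge
      where
      split : MaximalStable E s → OneSide (MaximalStable (E on inj₁)) (MaximalStable (E on inj₂)) s
      split (st , maximal) with nonempty? (s ∘ inj₁)
      ... | yes (a , a∈s) = inj₁ ((stable-restrictˡ st , maximal₁) , s₂-empty)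
        where
        s₂-empty : Empty (s ∘ inj₂)
        s₂-empty b b∈s = st (inj₁ a) (inj₂ b) a∈s b∈s (complete a b)
        maximal₁ : ∀ s′ → Stable (E on inj₁) s′ → (s ∘ inj₁) ⊆ s′ → s′ ⊆ (s ∘ inj₁)
        maximal₁ s′ st′ s₁⊆s′ a = maximal [ s′ , const false ] (stable-emptyʳ st′ λ _ ())
          (⊆-⊎ s₁⊆s′ λ b b∈s → ⊥-elim (s₂-empty b b∈s)) (inj₁ a)
      ... | no s₁-empty = inj₂ ((λ a a∈s → s₁-empty (a , a∈s)) , (stable-restrictʳ st , maximal₂))
        where
        maximal₂ : ∀ s′ → Stable (E on inj₂) s′ → (s ∘ inj₂) ⊆ s′ → s′ ⊆ (s ∘ inj₂)
        maximal₂ s′ st′ s₂⊆s′ b = maximal [ const false , s′ ] (stable-emptyˡ (λ _ ()) st′)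
          (⊆-⊎ (λ a a∈s → ⊥-elim (s₁-empty (a , a∈s))) s₂⊆s′) (inj₂ b)
      merge : OneSide (MaximalStable (E on inj₁)) (MaximalStable (E on inj₂)) s → MaximalStable E s
      merge (inj₁ (max₁@(st₁ , maximal₁) , s₂-empty)) =
        stable-emptyʳ st₁ s₂-empty ,
        λ s′ st′ s⊆s′ → ⊆-⊎
          (maximal₁ (s′ ∘ inj₁) (stable-restrictˡ st′) (λ a → s⊆s′ (inj₁ a)))
          (λ b b∈s′ → let (a , a∈s) = nonempty₁ max₁ in
                      ⊥-elim (st′ (inj₁ a) (inj₂ b) (s⊆s′ (inj₁ a) a∈s) b∈s′ (complete a b)))
      merge (inj₂ (s₁-empty , max₂@(st₂ , maximal₂))) =
        stable-emptyˡ s₁-empty st₂ ,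
        λ s′ st′ s⊆s′ → ⊆-⊎
          (λ a a∈s′ → let (b , b∈s) = nonempty₂ max₂ in
                      ⊥-elim (st′ (inj₁ a) (inj₂ b) a∈s′ (s⊆s′ (inj₂ b) b∈s) (complete a b)))
          (maximal₂ (s′ ∘ inj₂) (stable-restrictʳ st′) (λ b → s⊆s′ (inj₂ b)))

data Polarity : Set where
  resolution coresolution : Polarity

dual : Polarity → Polarity
dual resolution   = coresolution
dual coresolution = resolution

module _ {K : Set} where

  leaf : (φ : Formula K) → Leaf φ
  leaf (atom _)  = tt
  leaf (φ and _) = inj₁ (leaf φ)
  leaf (φ or _)  = inj₁ (leaf φ)

  anyLeaf≡true : (φ : Formula K) {p : Leaf φ → Bool} → anyLeaf φ p ≡ true ⇔ (∃ λ x → p x ≡ true)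
  anyLeaf≡true (atom _)  = mk⇔ (tt ,_) proj₂
  anyLeaf≡true (φ and ψ) = ∨≡true-⊎ (anyLeaf≡true φ) (anyLeaf≡true ψ)
  anyLeaf≡true (φ or ψ)  = ∨≡true-⊎ (anyLeaf≡true φ) (anyLeaf≡true ψ)

  nonempty? : (φ : Formula K) (s : Subset φ) → Dec (Nonempty s)
  nonempty? φ s = map′ (to (anyLeaf≡true φ)) (from (anyLeaf≡true φ)) (anyLeaf φ s ≟ true)

  -- Res resolution φ and Res coresolution φ are S and S^⊥, described by recursion on φ.
  Res : Polarity → (φ : Formula K) → Subset φ → Set
  Res _            (atom _)  s = tt ∈ s
  Res resolution   (φ and ψ) s = OneSide   (Res resolution φ)   (Res resolution ψ)   s
  Res coresolution (φ and ψ) s = BothSides (Res coresolution φ) (Res coresolution ψ) s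
  Res resolution   (φ or ψ)  s = BothSides (Res resolution φ)   (Res resolution ψ)   s
  Res coresolution (φ or ψ)  s = OneSide   (Res coresolution φ) (Res coresolution ψ) s

  Res-covers : ∀ p (φ : Formula K) → Covers (Res p φ)
  Res-covers _ (atom _) _ = const true , refl , refl
  Res-covers resolution (φ and ψ) =
    OneSide-covers (Res-covers resolution φ) (Res-covers resolution ψ)
  Res-covers coresolution (φ and ψ) =
    BothSides-covers (Res-covers coresolution φ) (Res-covers coresolution ψ) (leaf φ) (leaf ψ)
  Res-covers resolution (φ or ψ) =
    BothSides-covers (Res-covers resolution φ) (Res-covers resolution ψ) (leaf φ) (leaf ψ)
  Res-covers coresolution (φ or ψ) =
    OneSide-covers (Res-covers coresolution φ) (Res-covers coresolution ψ)

  Res⇔Orth-dual : ∀ p (φ : Formula K) u → Res p φ u ⇔ Orth (Res (dual p) φ) u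
  Res⇔Orth-dual _ (atom _) _ =
    mk⇔ (λ tt∈u _ tt∈α → tt , tt∈u , tt∈α , λ _ _ _ → refl)
        (λ u⟂ → proj₁ (proj₂ (u⟂ (const true) refl)))
  Res⇔Orth-dual resolution (φ and ψ) u =
    ⇔-sym (Orth-BothSides (Res-covers coresolution φ) (Res-covers coresolution ψ)
                          (leaf φ) (leaf ψ) u)
    ⇔-∘ OneSide-cong (Res⇔Orth-dual resolution φ) (Res⇔Orth-dual resolution ψ) u
  Res⇔Orth-dual coresolution (φ and ψ) u =
    ⇔-sym (Orth-OneSide u)
    ⇔-∘ BothSides-cong (Res⇔Orth-dual coresolution φ) (Res⇔Orth-dual coresolution ψ) u
  Res⇔Orth-dual resolution (φ or ψ) u =
    ⇔-sym (Orth-OneSide u)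
    ⇔-∘ BothSides-cong (Res⇔Orth-dual resolution φ) (Res⇔Orth-dual resolution ψ) u
  Res⇔Orth-dual coresolution (φ or ψ) u =
    ⇔-sym (Orth-BothSides (Res-covers resolution φ) (Res-covers resolution ψ)
                          (leaf φ) (leaf ψ) u)
    ⇔-∘ OneSide-cong (Res⇔Orth-dual coresolution φ) (Res⇔Orth-dual coresolution ψ) u

  Res-nonempty : ∀ p (φ : Formula K) {s} → Res p φ s → Nonempty s
  Res-nonempty p φ s∈Res =
    let (α , α∈Res , _) = Res-covers (dual p) φ (leaf φ)
        (x , x∈s , _)   = to (Res⇔Orth-dual p φ _) s∈Res α α∈Res
    in x , x∈s

  IsResolution⇔Res : (φ : Formula K) (s : Subset φ) → IsResolution φ s ⇔ Res resolution φ s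
  IsResolution⇔Res (atom _) _ =
    mk⇔ (λ (_ , maximal) → maximal (const true) (λ _ _ _ _ ()) (λ _ _ → refl) tt refl)
        (λ tt∈s → (λ _ _ _ _ ()) , λ _ _ _ _ _ → tt∈s)
  IsResolution⇔Res (φ and ψ) s =
    OneSide-cong (IsResolution⇔Res φ) (IsResolution⇔Res ψ) s
    ⇔-∘ maximalStable-join (MeetAnd (φ and ψ)) (λ _ _ → tt)
                           (nonempty φ) (nonempty ψ) (nonempty? φ) s
    where
    nonempty : (φ : Formula K) {s : Subset φ} → IsResolution φ s → Nonempty s
    nonempty φ = Res-nonempty resolution φ ∘ to (IsResolution⇔Res φ _)
  IsResolution⇔Res (φ or ψ) s =
    BothSides-cong (IsResolution⇔Res φ) (IsResolution⇔Res ψ) s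
    ⇔-∘ maximalStable-union (MeetAnd (φ or ψ)) (λ _ _ → (λ ()) , (λ ())) s

  biorthogonal⇒IsResolution : (φ : Formula K) {u : Subset φ} →
                              Orth (IsCoresolution φ) u → IsResolution φ u
  biorthogonal⇒IsResolution φ u⟂ =
    from (IsResolution⇔Res φ _)
      (from (Res⇔Orth-dual resolution φ _) λ α α∈Res → u⟂ α (isCoresolution α∈Res))
    where
    isCoresolution : ∀ {α} → Res coresolution φ α → IsCoresolution φ α
    isCoresolution α∈Res s s-res =
      to (Res⇔Orth-dual coresolution φ _) α∈Res s (to (IsResolution⇔Res φ s) s-res)

module _ {K : Set} (φ ψ : Formula K) (R : Rel φ ψ) where

  ∈-preimage : ∀ {t x} → x ∈ preimage φ ψ R t ⇔ (∃ λ y → y ∈ t × R x y ≡ true)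
  ∈-preimage = mk⇔ (map₂ (to ∧≡true) ∘ to (anyLeaf≡true ψ))
                   (from (anyLeaf≡true ψ) ∘ map₂ (from ∧≡true))

  ∈-image : ∀ {α y} → y ∈ image φ ψ R α ⇔ (∃ λ x → x ∈ α × R x y ≡ true)
  ∈-image = mk⇔ (map₂ (to ∧≡true) ∘ to (anyLeaf≡true φ))
                (from (anyLeaf≡true φ) ∘ map₂ (from ∧≡true))

  UniqueLink : Subset φ → Subset ψ → Set
  UniqueLink α t = Σ (Leaf φ × Leaf ψ) λ (x , y) →
    x ∈ α × y ∈ t × R x y ≡ true ×
    (∀ x′ y′ → x′ ∈ α → y′ ∈ t → R x′ y′ ≡ true → (x′ , y′) ≡ (x , y))

  uniqueLink⇔⟂ : ∀ {α t} → UniqueLink α t ⇔ (α ⟂ preimage φ ψ R t × image φ ψ R α ⟂ t)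
  uniqueLink⇔⟂ {α} {t} = mk⇔ split merge
    where
    split : UniqueLink α t → α ⟂ preimage φ ψ R t × image φ ψ R α ⟂ t
    split ((x , y) , x∈α , y∈t , xRy , unique) =
      ( x , x∈α , from ∈-preimage (y , y∈t , xRy)
      , λ x′ x′∈α x′∈R⁻¹t → let (y′ , y′∈t , x′Ry′) = to ∈-preimage x′∈R⁻¹t in
                             cong proj₁ (unique x′ y′ x′∈α y′∈t x′Ry′))
      , ( y , from ∈-image (x , x∈α , xRy) , y∈t
        , λ y′ y′∈Rα y′∈t → let (x′ , x′∈α , x′Ry′) = to ∈-image y′∈Rα in
                             cong proj₂ (unique x′ y′ x′∈α y′∈t x′Ry′))
    merge : α ⟂ preimage φ ψ R t × image φ ψ R α ⟂ t → UniqueLink α t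
    merge ((x , x∈α , x∈R⁻¹t , uniqueˣ) , (y , _ , y∈t , uniqueʸ)) =
      let (y₀ , y₀∈t , xRy₀) = to ∈-preimage x∈R⁻¹t
          y₀≡y = uniqueʸ y₀ (from ∈-image (x , x∈α , xRy₀)) y₀∈t
      in (x , y) , x∈α , y∈t , subst (λ y → R x y ≡ true) y₀≡y xRy₀ ,
         λ x′ y′ x′∈α y′∈t x′Ry′ →
           cong₂ _,_ (uniqueˣ x′ x′∈α (from ∈-preimage (y′ , y′∈t , x′Ry′)))
                     (uniqueʸ y′ (from ∈-image (x′ , x′∈α , x′Ry′)) y′∈t)

proposition1 : (K : Set) (φ ψ : Formula K) (R : Rel φ ψ) →
    RespectsLabels φ ψ R →
    ResolutionCondition φ ψ R ⇔ UniquePair φ ψ R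
-- The equivalence does not depend on R respecting labels.
proposition1 K φ ψ R _ = mk⇔ unique-pair resolution-condition
  where
  unique-pair : ResolutionCondition φ ψ R → UniquePair φ ψ R
  unique-pair (preimage-res , image-cores) t t-res α α-cores =
    from (uniqueLink⇔⟂ φ ψ R) (α-cores _ (preimage-res t t-res) , image-cores α α-cores t t-res)

  resolution-condition : UniquePair φ ψ R → ResolutionCondition φ ψ R
  resolution-condition unique =
    (λ t t-res → biorthogonal⇒IsResolution φ λ α α-cores →
                   ⟂-sym (proj₁ (to (uniqueLink⇔⟂ φ ψ R) (unique t t-res α α-cores)))) ,
    (λ α α-cores t t-res → proj₂ (to (uniqueLink⇔⟂ φ ψ R) (unique t t-res α α-cores)))
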